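{- The subgroup of the free group $F_2=\langle a,b\rangle$ generated by $aba^{ -1}b^{ -1}a$ and $b$ is malnormal in $F_2$.
   Context: A subgroup $H\le G$ is malnormal if $H\cap gHg^{ -1}=\{1\}$ for all $g\in G\setminus H$. -}

module Defs where

open import Data.Bool using (Bool; true; false; not)
open import Data.Product using (_×_; _,_; ∃-syntax)
open import Data.List using (List; []; _∷_; _++_; foldr; reverse; map; concatMap)
open import Relation.Binary.PropositionalEquality using (_≡_)
open import Relation.Nullary using (¬_)

-- Free group F₂ = ⟨ a , b ⟩, modelled by words in a^{±1}, b^{±1}
-- modulo free reduction (two words are equal in F₂ iff their free
-- reductions coincide).

data Gen : Set where
  a b : Gen

-- (x , true) is x, (x , false) is x⁻¹
Letter : Set
Letter = Gen × Bool

Word : Set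
Word = List Letter

invL : Letter → Letter
invL (x , s) = (x , not s)

cancels : Letter → Letter → Bool
cancels (a , true)  (a , false) = true
cancels (a , false) (a , true)  = true
cancels (b , true)  (b , false) = true
cancels (b , false) (b , true)  = true
cancels _ _ = false

push : Letter → Word → Word
push l [] = l ∷ []
push l (m ∷ w) with cancels l m
... | true  = w
... | false = l ∷ m ∷ w

reduce : Word → Word
reduce w = foldr push [] w

_·_ : Word → Word → Word
u · v = u ++ v

infixl 7 _·_

_⁻¹ : Word → Word
w ⁻¹ = reverse (map invL w)

e : Word
e = []

_≈_ : Word → Word → Set
u ≈ v = reduce u ≡ reduce v

infix 4 _≈_

A B : Letter
A = (a , true)
B = (b , true)

Ai Bi : Letter
Ai = (a , false)
Bi = (b , false)

x : Word
x = A ∷ B ∷ Ai ∷ Bi ∷ A ∷ []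

data HGen : Set where
  gx gb : HGen

hgen : HGen → Word
hgen gx = x
hgen gb = B ∷ []

hletter : HGen × Bool → Word
hletter (h , true)  = hgen h
hletter (h , false) = hgen h ⁻¹

_∈H : Word → Set
g ∈H = ∃[ hs ] (concatMap hletter hs ≈ g)

module Submission where

-- Proof (Stallings graphs).  The Stallings graph Γ of H has vertices
-- s0, …, s4: the cycle s0 -a→ s1 -b→ s2 -a⁻¹→ s3 -b⁻¹→ s4 -a→ s0 reads x,
-- and a loop s0 -b→ s0 reads b.  A right coset of H is a pair (s , r) of a
-- vertex of Γ and a reduced "hair" r leaving Γ at s; F₂ acts on these
-- cosets (`act`), and the stabiliser of the base coset (s0 , []) is
-- exactly H (a spanning tree of Γ yields H-words for every step).
--   The heart of the argument: the off-diagonal part of the product graph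
-- Γ × Γ is a disjoint union of lines, so it carries no reduced cycle;
-- hence no non-trivial reduced word is a loop at two distinct vertices
-- of Γ.  Peeling off hairs, it follows that a non-trivial reduced loop of
-- Γ at q fixes no coset other than (q , []).  Now if h ∈ H is non-trivial
-- and g h g⁻¹ ∈ H, then h fixes both the base coset and its image under
-- g, so these cosets coincide and g ∈ H.

open import Defs
open import Data.Bool using (Bool; true; false)
open import Data.Bool.Properties using (not-involutive) renaming (_≟_ to _≟ᵇ_)
open import Data.Empty using (⊥; ⊥-elim)
open import Data.Fin using (Fin; zero; suc)
open import Data.Fin.Properties using (all?) renaming (_≟_ to _≟ˢ_)
open import Data.List using (List; []; _∷_; _++_; foldr; foldl; map; reverse; length; concatMap; last; _ʳ++_)
open import Data.List.Properties
  using (foldr-++; foldl-++; ++-assoc; ++-identityʳ; concatMap-++; unfold-reverse; length-ʳ++)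
  renaming (≡-dec to list-≡-dec)
open import Data.List.Relation.Unary.Linked using (Linked; []; [-]; _∷_; tail)
open import Data.Maybe using (Maybe; just; nothing; zip)
open import Data.Maybe.Properties using (just-injective) renaming (≡-dec to maybe-≡-dec)
open import Data.Maybe.Relation.Unary.All using (All; just; nothing; drop-just) renaming (dec to all-dec)
open import Data.Nat using (ℕ; _<_)
open import Data.Nat.Properties using (<-trans; <-irrefl; <-cmp; _<?_; m+1+n≢n) renaming (_≟_ to _≟ⁿ_)
open import Data.Product using (_×_; _,_; proj₂; ∃-syntax)
open import Data.Product.Properties using () renaming (≡-dec to ×-≡-dec)
open import Data.Sum using (_⊎_; inj₁; inj₂; swap)
open import Function using (flip)
open import Relation.Binary using (Setoid; DecidableEquality; Transitive; tri<; tri≈; tri>)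
import Relation.Binary.Construct.On as On
import Relation.Binary.Reasoning.Setoid as SetoidReasoning
open import Level using (0ℓ)
open import Relation.Binary.PropositionalEquality
open import Relation.Nullary using (¬_; Dec; yes; no; ¬?; _×-dec_; _→-dec_)
open import Relation.Nullary.Decidable using (from-yes; map′)

_≟ᵍ_ : DecidableEquality Gen
a ≟ᵍ a = yes refl
a ≟ᵍ b = no λ ()
b ≟ᵍ a = no λ ()
b ≟ᵍ b = yes refl

_≟ˡ_ : DecidableEquality Letter
_≟ˡ_ = ×-≡-dec _≟ᵍ_ _≟ᵇ_

∀-letter? : {P : Letter → Set} → (∀ l → Dec (P l)) → Dec (∀ l → P l)
∀-letter? {P} P? =
  map′ every (λ f → f A , f Ai , f B , f Bi) (P? A ×-dec P? Ai ×-dec P? B ×-dec P? Bi)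
  where
    every : P A × P Ai × P B × P Bi → ∀ l → P l
    every (pA , pAi , pB , pBi) (a , true)  = pA
    every (pA , pAi , pB , pBi) (a , false) = pAi
    every (pA , pAi , pB , pBi) (b , true)  = pB
    every (pA , pAi , pB , pBi) (b , false) = pBi

invL-involutive : ∀ l → invL (invL l) ≡ l
invL-involutive (g , s) = cong (g ,_) (not-involutive s)

cancels-invL : ∀ l → cancels l (invL l) ≡ true
cancels-invL = from-yes (∀-letter? λ l → cancels l (invL l) ≟ᵇ true)

cancels-invLˡ : ∀ l → cancels (invL l) l ≡ true
cancels-invLˡ = from-yes (∀-letter? λ l → cancels (invL l) l ≟ᵇ true)

cancels⇒invL : ∀ l m → cancels l m ≡ true → m ≡ invL l
cancels⇒invL = from-yes (∀-letter? λ l → ∀-letter? λ m →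
  (cancels l m ≟ᵇ true) →-dec (m ≟ˡ invL l))

cancels-sym : ∀ l m → cancels l m ≡ cancels m l
cancels-sym = from-yes (∀-letter? λ l → ∀-letter? λ m → cancels l m ≟ᵇ cancels m l)

no-backtrack : ∀ {l m} → cancels l m ≡ false → invL l ≢ m
no-backtrack {l} noncancel refl with trans (sym (cancels-invL l)) noncancel
... | ()

Reduced : Word → Set
Reduced = Linked (λ l m → cancels l m ≡ false)

push-cancels : ∀ {l m} w → cancels l m ≡ true → push l (m ∷ w) ≡ w
push-cancels w eq rewrite eq = refl

push-extends : ∀ {l m} w → cancels l m ≡ false → push l (m ∷ w) ≡ l ∷ m ∷ w
push-extends w eq rewrite eq = refl

push-reduced : ∀ l {w} → Reduced w → Reduced (push l w)
push-reduced l {[]}    _   = [-]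
push-reduced l {m ∷ w} red with cancels l m in eq
... | true  = tail red
... | false = eq ∷ red

foldr-push-reduced : ∀ {z} u → Reduced z → Reduced (foldr push z u)
foldr-push-reduced []      red = red
foldr-push-reduced (l ∷ u) red = push-reduced l (foldr-push-reduced u red)

reduce-reduced : ∀ w → Reduced (reduce w)
reduce-reduced w = foldr-push-reduced w []

push-prepends : ∀ {l w} → Reduced (l ∷ w) → push l w ≡ l ∷ w
push-prepends [-]             = refl
push-prepends (noncancel ∷ _) = push-extends _ noncancel

reduce-of-reduced : ∀ {w} → Reduced w → reduce w ≡ w
reduce-of-reduced {[]}    _   = refl
reduce-of-reduced {l ∷ w} red = trans (cong (push l) (reduce-of-reduced (tail red))) (push-prepends red)

push-invL : ∀ l {w} → Reduced w → push l (push (invL l) w) ≡ w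
push-invL l {[]}    _   = push-cancels [] (cancels-invL l)
push-invL l {m ∷ w} red with cancels (invL l) m in eq
... | false = push-cancels (m ∷ w) (cancels-invL l)
... | true with trans (cancels⇒invL (invL l) m eq) (invL-involutive l)
...   | refl = push-prepends red

foldr-push-push : ∀ {z} l y → Reduced z → foldr push z (push l y) ≡ push l (foldr push z y)
foldr-push-push l []      _  = refl
foldr-push-push l (m ∷ y) rz with cancels l m in eq
... | false = refl
... | true with cancels⇒invL l m eq
...   | refl = sym (push-invL l (foldr-push-reduced y rz))

foldr-push-reduce : ∀ {z} u → Reduced z → foldr push z u ≡ foldr push z (reduce u)
foldr-push-reduce []      _  = refl
foldr-push-reduce (l ∷ u) rz =
  trans (cong (push l) (foldr-push-reduce u rz)) (sym (foldr-push-push l (reduce u) rz))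

reduce-· : ∀ u v → reduce (u · v) ≡ foldr push (reduce v) u
reduce-· u v = foldr-++ push [] u v

F₂ : Setoid 0ℓ 0ℓ
F₂ = On.setoid (setoid Word) reduce

reduce-·-reduce : ∀ u v → reduce (u · v) ≡ foldr push (reduce v) (reduce u)
reduce-·-reduce u v = trans (reduce-· u v) (foldr-push-reduce u (reduce-reduced v))

·-congˡ : ∀ u v v′ → v ≈ v′ → u · v ≈ u · v′
·-congˡ u v v′ v≈v′ = begin
  reduce (u · v)                    ≡⟨ reduce-·-reduce u v ⟩
  foldr push (reduce v) (reduce u)  ≡⟨ cong (λ z → foldr push z (reduce u)) v≈v′ ⟩
  foldr push (reduce v′) (reduce u) ≡⟨ sym (reduce-·-reduce u v′) ⟩
  reduce (u · v′)                   ∎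
  where open ≡-Reasoning

·-congʳ : ∀ u u′ v → u ≈ u′ → u · v ≈ u′ · v
·-congʳ u u′ v u≈u′ = begin
  reduce (u · v)                    ≡⟨ reduce-·-reduce u v ⟩
  foldr push (reduce v) (reduce u)  ≡⟨ cong (foldr push (reduce v)) u≈u′ ⟩
  foldr push (reduce v) (reduce u′) ≡⟨ sym (reduce-·-reduce u′ v) ⟩
  reduce (u′ · v)                   ∎
  where open ≡-Reasoning

cancel-pair : ∀ u {l m} → cancels l m ≡ true → u · (l ∷ m ∷ []) ≈ u
cancel-pair u {l} {m} eq = begin
  u · (l ∷ m ∷ []) ≈⟨ ·-congˡ u (l ∷ m ∷ []) e (push-cancels [] eq) ⟩
  u · e            ≡⟨ ++-identityʳ u ⟩
  u                ∎
  where open SetoidReasoning F₂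

⁻¹-∷ : ∀ l w → (l ∷ w) ⁻¹ ≡ w ⁻¹ · (invL l ∷ [])
⁻¹-∷ l w = unfold-reverse (invL l) (map invL w)

inverseʳ : ∀ w → w · w ⁻¹ ≈ e
inverseʳ []      = refl
inverseʳ (l ∷ w) = begin
  (l ∷ w) · (l ∷ w) ⁻¹          ≡⟨ cong ((l ∷ w) ·_) (⁻¹-∷ l w) ⟩
  (l ∷ []) · (w · (w ⁻¹ · l⁻¹)) ≡⟨ cong (l ∷_) (sym (++-assoc w (w ⁻¹) l⁻¹)) ⟩
  (l ∷ []) · (w · w ⁻¹ · l⁻¹)   ≈⟨ ·-congˡ (l ∷ []) (w · w ⁻¹ · l⁻¹) l⁻¹
                                     (·-congʳ (w · w ⁻¹) e l⁻¹ (inverseʳ w)) ⟩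
  e · (l ∷ invL l ∷ [])         ≈⟨ cancel-pair e (cancels-invL l) ⟩
  e                             ∎
  where
    l⁻¹ : Word
    l⁻¹ = invL l ∷ []
    open SetoidReasoning F₂

inverseˡ : ∀ w → w ⁻¹ · w ≈ e
inverseˡ []      = refl
inverseˡ (l ∷ w) = begin
  (l ∷ w) ⁻¹ · (l ∷ w)          ≡⟨ cong (_· (l ∷ w)) (⁻¹-∷ l w) ⟩
  w ⁻¹ · (invL l ∷ []) · (l ∷ w)≡⟨ ++-assoc (w ⁻¹) (invL l ∷ []) (l ∷ w) ⟩
  w ⁻¹ · (pair · w)             ≈⟨ ·-congˡ (w ⁻¹) (pair · w) w
                                     (·-congʳ pair e w (cancel-pair e (cancels-invLˡ l))) ⟩
  w ⁻¹ · w                      ≈⟨ inverseˡ w ⟩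
  e                             ∎
  where
    pair : Word
    pair = invL l ∷ l ∷ []
    open SetoidReasoning F₂

·⁻¹·-cancel : ∀ u v → u · v ⁻¹ · v ≈ u
·⁻¹·-cancel u v = begin
  u · v ⁻¹ · v     ≡⟨ ++-assoc u (v ⁻¹) v ⟩
  u · (v ⁻¹ · v)   ≈⟨ ·-congˡ u (v ⁻¹ · v) e (inverseˡ v) ⟩
  u · e            ≡⟨ ++-identityʳ u ⟩
  u                ∎
  where open SetoidReasoning F₂

··⁻¹-cancel : ∀ u v → u · v · v ⁻¹ ≈ u
··⁻¹-cancel u v = begin
  u · v · v ⁻¹     ≡⟨ ++-assoc u v (v ⁻¹) ⟩
  u · (v · v ⁻¹)   ≈⟨ ·-congˡ u (v · v ⁻¹) e (inverseʳ v) ⟩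
  u · e            ≡⟨ ++-identityʳ u ⟩
  u                ∎
  where open SetoidReasoning F₂

conjugate-trivial : ∀ g h → h ≈ e → g · h · g ⁻¹ ≈ e
conjugate-trivial g h h≈e = begin
  g · h · g ⁻¹    ≈⟨ ·-congʳ (g · h) (g · e) (g ⁻¹) (·-congˡ g h e h≈e) ⟩
  g · e · g ⁻¹    ≡⟨ cong (_· g ⁻¹) (++-identityʳ g) ⟩
  g · g ⁻¹        ≈⟨ inverseʳ g ⟩
  e               ∎
  where open SetoidReasoning F₂

∈H-resp-≈ : ∀ u v → u ≈ v → u ∈H → v ∈H
∈H-resp-≈ u v u≈v (ts , ts≈u) = ts , trans ts≈u u≈v

∈H-· : ∀ u v → u ∈H → v ∈H → (u · v) ∈H
∈H-· u v (ts , ts≈u) (ts′ , ts′≈v) = ts ++ ts′ , (begin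
  concatMap hletter (ts ++ ts′) ≡⟨ concatMap-++ hletter ts ts′ ⟩
  word ts · word ts′            ≈⟨ ·-congʳ (word ts) u (word ts′) ts≈u ⟩
  u · word ts′                  ≈⟨ ·-congˡ u (word ts′) v ts′≈v ⟩
  u · v                         ∎)
  where
    word : List (HGen × Bool) → Word
    word = concatMap hletter
    open SetoidReasoning F₂

≈⇒∈H : ∀ u v → u ≈ v → (u · v ⁻¹) ∈H
≈⇒∈H u v u≈v = [] , sym (trans (·-congʳ u v (v ⁻¹) u≈v) (inverseʳ v))

-- A deterministic graph whose edges are labelled by letters: γ P l is the
-- end of the l-edge leaving P, if there is one.
Graph : Set → Set
Graph V = V → Letter → Maybe V

data Path {V : Set} (γ : Graph V) : V → Word → V → Set where
  []  : ∀ {P} → Path γ P [] P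
  _∷_ : ∀ {P l Q w R} → γ P l ≡ just Q → Path γ Q w R → Path γ P (l ∷ w) R

path-++ : ∀ {V} {γ : Graph V} {P Q R u v} → Path γ P u Q → Path γ Q v R → Path γ P (u · v) R
path-++ []         q = q
path-++ (edge ∷ p) q = edge ∷ path-++ p q

at-just : ∀ {X : Set} {P : X → Set} {m x} → All P m → m ≡ just x → P x
at-just (just p) refl = p

State : Set
State = Fin 5

pattern s0 = zero
pattern s1 = suc zero
pattern s2 = suc (suc zero)
pattern s3 = suc (suc (suc zero))
pattern s4 = suc (suc (suc (suc zero)))

δ : Graph State
δ s0 (a , true)  = just s1
δ s1 (b , true)  = just s2
δ s2 (a , false) = just s3
δ s3 (b , false) = just s4
δ s4 (a , true)  = just s0
δ s0 (b , true)  = just s0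
δ s1 (a , false) = just s0
δ s2 (b , false) = just s1
δ s3 (a , true)  = just s2
δ s4 (b , true)  = just s3
δ s0 (a , false) = just s4
δ s0 (b , false) = just s0
δ _  _           = nothing

∀-state? : {P : State → Set} → (∀ s → Dec (P s)) → Dec (∀ s → P s)
∀-state? = all?

δ-reverse-table : ∀ s l → All (λ t → δ t (invL l) ≡ just s) (δ s l)
δ-reverse-table = from-yes (∀-state? λ s → ∀-letter? λ l →
  all-dec (λ t → maybe-≡-dec _≟ˢ_ (δ t (invL l)) (just s)) (δ s l))

δ-reverse : ∀ {s l t} → δ s l ≡ just t → δ t (invL l) ≡ just s
δ-reverse {s} {l} = at-just (δ-reverse-table s l)

-- Right cosets of H.  (s , r) stands for the vertex s of Γ followed by the
-- hair reverse r, a reduced word whose first letter leaves Γ at s; the hair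
-- is stored reversed, most recent letter first.
Coset : Set
Coset = State × Word

Valid : Coset → Set
Valid (s , r) = Reduced r × All (λ m → δ s m ≡ nothing) (last r)

base : Coset
base = s0 , []

valid-core : ∀ {s} → Valid (s , [])
valid-core = [] , nothing

leave : State → Letter → Maybe State → Coset
leave s l (just t) = t , []
leave s l nothing  = s , l ∷ []

step : Coset → Letter → Coset
step (s , [])    l = leave s l (δ s l)
step (s , m ∷ r) l = s , push l (m ∷ r)

act : Coset → Word → Coset
act = foldl step

act-· : ∀ c u v → act c (u · v) ≡ act (act c u) v
act-· = foldl-++ step

valid-tail : ∀ {s m r} → Valid (s , m ∷ r) → Valid (s , r)
valid-tail {r = []}    _            = valid-core
valid-tail {r = _ ∷ _} (red , root) = tail red , root

step-valid : ∀ c l → Valid c → Valid (step c l)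
step-valid (s , []) l _ with δ s l in eq
... | just t  = [] , nothing
... | nothing = [-] , just eq
step-valid (s , m ∷ r) l valid@(red , root) with cancels l m in eq
... | true  = valid-tail valid
... | false = eq ∷ red , root

act-valid : ∀ c w → Valid c → Valid (act c w)
act-valid c []      valid = valid
act-valid c (l ∷ w) valid = act-valid (step c l) w (step-valid c l valid)

step-inverse : ∀ c l → Valid c → step (step c l) (invL l) ≡ c
step-inverse (s , []) l _ with δ s l in eq
... | just t  rewrite δ-reverse eq = refl
... | nothing rewrite cancels-invLˡ l = refl
step-inverse (s , m ∷ r) l (red , root) with cancels l m in eq
... | false rewrite cancels-invLˡ l = refl
... | true with cancels⇒invL l m eq
step-inverse (s , .(invL l) ∷ []) l (_ , just root) | true | refl
  rewrite root = refl
step-inverse (s , .(invL l) ∷ n ∷ r) l (noncancel ∷ _ , _) | true | refl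
  rewrite noncancel = refl

act-push : ∀ c l v → Valid c → act c (push l v) ≡ act c (l ∷ v)
act-push c l []      _     = refl
act-push c l (m ∷ v) valid with cancels l m in eq
... | false = refl
... | true with cancels⇒invL l m eq
...   | refl = cong (λ c′ → act c′ v) (sym (step-inverse c l valid))

act-reduce : ∀ c w → Valid c → act c (reduce w) ≡ act c w
act-reduce c []      _     = refl
act-reduce c (l ∷ w) valid =
  trans (act-push c l (reduce w) valid) (act-reduce (step c l) w (step-valid c l valid))

act-resp-≈ : ∀ c u v → Valid c → u ≈ v → act c u ≡ act c v
act-resp-≈ c u v valid u≈v =
  trans (sym (act-reduce c u valid)) (trans (cong (act c) u≈v) (act-reduce c v valid))

act-conjugate : ∀ c g h → Valid c → act c (g · h · g ⁻¹) ≡ c → act (act c g) h ≡ act c g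
act-conjugate c g h valid fixed = begin
  act (act c g) h              ≡⟨ sym (act-· c g h) ⟩
  act c (g · h)                ≡⟨ act-resp-≈ c (g · h) (g · h · g ⁻¹ · g) valid
                                    (sym (·⁻¹·-cancel (g · h) g)) ⟩
  act c (g · h · g ⁻¹ · g)     ≡⟨ act-· c (g · h · g ⁻¹) g ⟩
  act (act c (g · h · g ⁻¹)) g ≡⟨ cong (λ c′ → act c′ g) fixed ⟩
  act c g                      ∎
  where open ≡-Reasoning

-- The stabiliser of the base coset is H: the generators fix it, and
-- conversely a spanning tree of Γ turns every fixing word into an H-word.
generator-fixes-base : ∀ t → act base (hletter t) ≡ base
generator-fixes-base (gx , true)  = refl
generator-fixes-base (gx , false) = refl
generator-fixes-base (gb , true)  = refl
generator-fixes-base (gb , false) = refl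

H-fixes-base : ∀ w → w ∈H → act base w ≡ base
H-fixes-base w (ts , ts≈w) =
  trans (sym (act-resp-≈ base (concatMap hletter ts) w valid-core ts≈w)) (products-fix ts)
  where
    products-fix : ∀ ts → act base (concatMap hletter ts) ≡ base
    products-fix []       = refl
    products-fix (t ∷ ts) = begin
      act base (hletter t · rest)        ≡⟨ act-· base (hletter t) rest ⟩
      act (act base (hletter t)) rest    ≡⟨ cong (λ c → act c rest) (generator-fixes-base t) ⟩
      act base rest                      ≡⟨ products-fix ts ⟩
      base                               ∎
      where
        rest : Word
        rest = concatMap hletter ts
        open ≡-Reasoning

-- Words along the spanning tree s0 -a→ s1 -b→ s2 -a⁻¹→ s3 -b⁻¹→ s4 of Γ.
tree : State → Word
tree s0 = []
tree s1 = A ∷ []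
tree s2 = A ∷ B ∷ []
tree s3 = A ∷ B ∷ Ai ∷ []
tree s4 = A ∷ B ∷ Ai ∷ Bi ∷ []

-- A word carrying the base coset to the given coset.
rep : Coset → Word
rep (s , r) = tree s · reverse r

rep-hair : ∀ s l r → rep (s , l ∷ r) ≡ rep (s , r) · (l ∷ [])
rep-hair s l r =
  trans (cong (tree s ·_) (unfold-reverse l r)) (sym (++-assoc (tree s) (reverse r) (l ∷ [])))

-- The two edges of Γ outside the spanning tree read the generators x and b.
edge-label : State → Letter → List (HGen × Bool)
edge-label s4 (a , true)  = (gx , true) ∷ []
edge-label s0 (a , false) = (gx , false) ∷ []
edge-label s0 (b , true)  = (gb , true) ∷ []
edge-label s0 (b , false) = (gb , false) ∷ []
edge-label _  _           = []

edge-label-table : ∀ s l →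
  All (λ t → concatMap hletter (edge-label s l) ≈ rep (s , []) · (l ∷ []) · rep (t , []) ⁻¹)
      (δ s l)
edge-label-table = from-yes (∀-state? λ s → ∀-letter? λ l →
  all-dec (λ t → list-≡-dec _≟ˡ_ (reduce (concatMap hletter (edge-label s l)))
                                 (reduce (rep (s , []) · (l ∷ []) · rep (t , []) ⁻¹))) (δ s l))

step-∈H : ∀ c l → (rep c · (l ∷ []) · rep (step c l) ⁻¹) ∈H
step-∈H (s , []) l with δ s l in eq
... | just t  = edge-label s l , at-just (edge-label-table s l) eq
... | nothing = ≈⇒∈H (rep (s , []) · (l ∷ [])) (rep (s , l ∷ []))
                     (cong reduce (sym (rep-hair s l [])))
step-∈H (s , m ∷ r) l with cancels l m in eq
... | false = ≈⇒∈H (rep (s , m ∷ r) · (l ∷ [])) (rep (s , l ∷ m ∷ r))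
                   (cong reduce (sym (rep-hair s l (m ∷ r))))
... | true  = ≈⇒∈H (rep (s , m ∷ r) · (l ∷ [])) (rep (s , r)) (begin
  rep (s , m ∷ r) · (l ∷ [])          ≡⟨ cong (_· (l ∷ [])) (rep-hair s m r) ⟩
  rep (s , r) · (m ∷ []) · (l ∷ [])   ≡⟨ ++-assoc (rep (s , r)) (m ∷ []) (l ∷ []) ⟩
  rep (s , r) · (m ∷ l ∷ [])          ≈⟨ cancel-pair (rep (s , r)) (trans (cancels-sym m l) eq) ⟩
  rep (s , r)                         ∎)
  where open SetoidReasoning F₂

path-∈H : ∀ c w → (rep c · (w · rep (act c w) ⁻¹)) ∈H
path-∈H c []      = ≈⇒∈H (rep c) (rep c) refl
path-∈H c (l ∷ w) =
  ∈H-resp-≈ (u · y ⁻¹ · (y · v)) (rep c · (l ∷ v)) regroup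
    (∈H-· (u · y ⁻¹) (y · v) (step-∈H c l) (path-∈H (step c l) w))
  where
    u y v : Word
    u = rep c · (l ∷ [])
    y = rep (step c l)
    v = w · rep (act (step c l) w) ⁻¹
    regroup : u · y ⁻¹ · (y · v) ≈ rep c · (l ∷ v)
    regroup = begin
      u · y ⁻¹ · (y · v)   ≡⟨ sym (++-assoc (u · y ⁻¹) y v) ⟩
      u · y ⁻¹ · y · v     ≈⟨ ·-congʳ (u · y ⁻¹ · y) u v (·⁻¹·-cancel u y) ⟩
      u · v                ≡⟨ ++-assoc (rep c) (l ∷ []) v ⟩
      rep c · (l ∷ v)      ∎
      where open SetoidReasoning F₂

stabiliser⊆H : ∀ w → act base w ≡ base → w ∈H
stabiliser⊆H w fixed =
  ∈H-resp-≈ (w · []) w (cong reduce (++-identityʳ w))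
    (subst (λ c → (w · rep c ⁻¹) ∈H) fixed (path-∈H base w))

path-act : ∀ {s w t} → Path δ s w t → act (s , []) w ≡ (t , [])
path-act []         = refl
path-act (edge ∷ p) rewrite edge = path-act p

hair-grows : ∀ {s l r} w → Reduced (l ∷ w) → act (s , l ∷ r) w ≡ (s , w ʳ++ (l ∷ r))
hair-grows []      _                 = refl
hair-grows {s} {l} {r} (m ∷ w) (noncancel ∷ red) =
  trans (cong (λ h → act (s , h) w) (push-extends r (trans (cancels-sym m l) noncancel)))
        (hair-grows w red)

ʳ++-longer : ∀ w {l : Letter} {r} → w ʳ++ (l ∷ r) ≢ r
ʳ++-longer w {l} {r} eq = m+1+n≢n (length w) (trans (sym (length-ʳ++ w)) (cong length eq))

core-path : ∀ {s t} w → Reduced w → act (s , []) w ≡ (t , []) → Path δ s w t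
core-path []          _   refl  = []
core-path {s} (l ∷ w) red moved with δ s l in eq
... | just _  = eq ∷ core-path w (tail red) moved
... | nothing = ⊥-elim (ʳ++-longer w (cong proj₂ (trans (sym (hair-grows w red)) moved)))

reduce-core-path : ∀ {s t} w → act (s , []) w ≡ (t , []) → Path δ s (reduce w) t
reduce-core-path {s} w moved =
  core-path (reduce w) (reduce-reduced w) (trans (act-reduce (s , []) w valid-core) moved)

-- Let Good be a set of vertices closed under edges, on which every edge
-- changes the height and at most one edge leaves a vertex downwards and at
-- most one upwards.  Then the Good part is a union of lines, and a reduced
-- path cannot turn back; in particular it cannot be closed.
module Lines {V : Set} (γ : Graph V) (Good : V → Set) (height : V → ℕ)
  (good-step  : ∀ {P l Q} → Good P → γ P l ≡ just Q → Good Q)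
  (reversible : ∀ {P l Q} → γ P l ≡ just Q → γ Q (invL l) ≡ just P)
  (moves      : ∀ {P l Q} → Good P → γ P l ≡ just Q → height P ≢ height Q)
  (one-down   : ∀ {P l m Q R} → Good P → γ P l ≡ just Q → γ P m ≡ just R →
                height Q < height P → height R < height P → l ≡ m)
  (one-up     : ∀ {P l m Q R} → Good P → γ P l ≡ just Q → γ P m ≡ just R →
                height P < height Q → height P < height R → l ≡ m)
  where

  oriented : ∀ {P l Q} → Good P → γ P l ≡ just Q → height P < height Q ⊎ height Q < height P
  oriented {P} {Q = Q} good edge with <-cmp (height P) (height Q)
  ... | tri< up _ _     = inj₁ up
  ... | tri≈ _ level _  = ⊥-elim (moves good edge level)
  ... | tri> _ _ down   = inj₂ down

  -- A reduced path that starts in direction ≺ keeps going in direction ≺: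
  -- turning back would use the unique backward edge, the one just traversed.
  module Monotone (_≺_ : ℕ → ℕ → Set) (≺-trans : Transitive _≺_)
    (≺-oriented : ∀ {P l Q} → Good P → γ P l ≡ just Q →
                  height P ≺ height Q ⊎ height Q ≺ height P)
    (one-back   : ∀ {P l m Q R} → Good P → γ P l ≡ just Q → γ P m ≡ just R →
                  height Q ≺ height P → height R ≺ height P → l ≡ m)
    where

    monotone : ∀ {P l Q w R} → Good P → γ P l ≡ just Q → Path γ Q w R → Reduced (l ∷ w) →
               height P ≺ height Q → height P ≺ height R
    monotone _    _    []           _                 forward = forward
    monotone good edge (edge′ ∷ p) (noncancel ∷ red) forward
      with ≺-oriented (good-step good edge) edge′
    ... | inj₁ forward′ = ≺-trans forward (monotone (good-step good edge) edge′ p red forward′)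
    ... | inj₂ back     = ⊥-elim (no-backtrack noncancel
                            (one-back (good-step good edge) (reversible edge) edge′ forward back))

  open Monotone _<_ <-trans oriented one-down using () renaming (monotone to ascending)
  open Monotone (flip _<_) (flip <-trans) (λ good edge → swap (oriented good edge)) one-up
    using () renaming (monotone to descending)

  no-reduced-cycle : ∀ {P w} → Good P → Reduced w → w ≢ [] → Path γ P w P → ⊥
  no-reduced-cycle _    _   w≢[] []      = w≢[] refl
  no-reduced-cycle good red _    (edge ∷ p) with oriented good edge
  ... | inj₁ up   = <-irrefl refl (ascending good edge p red up)
  ... | inj₂ down = <-irrefl refl (descending good edge p red down)

Pair : Set
Pair = State × State

δ² : Graph Pair
δ² (p , q) l = zip (δ p l) (δ q l)

zip-just : ∀ {X Y : Set} {m : Maybe X} {n : Maybe Y} {x y} →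
           zip m n ≡ just (x , y) → m ≡ just x × n ≡ just y
zip-just {m = just _} {n = just _} refl = refl , refl

pair-path : ∀ {p p′ q q′ w} → Path δ p w p′ → Path δ q w q′ → Path δ² (p , q) w (p′ , q′)
pair-path []          []           = []
pair-path (edge ∷ ps) (edge′ ∷ qs) = cong₂ zip edge edge′ ∷ pair-path ps qs

Distinct : Pair → Set
Distinct (p , q) = p ≢ q

δ²-reverse : ∀ {P l Q} → δ² P l ≡ just Q → δ² Q (invL l) ≡ just P
δ²-reverse edge = let (edge₁ , edge₂) = zip-just edge in
  cong₂ zip (δ-reverse edge₁) (δ-reverse edge₂)

-- Γ is folded, so two distinct vertices never reach the same vertex by one letter.
distinct-step : ∀ {P l Q} → Distinct P → δ² P l ≡ just Q → Distinct Q
distinct-step p≢q edge refl = let (edge₁ , edge₂) = zip-just edge in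
  p≢q (just-injective (trans (sym (δ-reverse edge₁)) (δ-reverse edge₂)))

-- Off the diagonal, the pairs reading a common letter form four lines;
-- the height of a pair is its position on its line:
--   (s1,s2) -a⁻¹→ (s0,s3) -b⁻¹→ (s0,s4) -a→ (s1,s0) -b→ (s2,s0) -a⁻¹→ (s3,s4),
--   (s4,s3) -a→ (s0,s2) -b⁻¹→ (s0,s1) -a⁻¹→ (s4,s0) -b→ (s3,s0) -a→ (s2,s1),
--   (s1,s4) -b→ (s2,s3),   and   (s3,s2) -b⁻¹→ (s4,s1).
height : Pair → ℕ
height (s0 , s3) = 1
height (s0 , s4) = 2
height (s1 , s0) = 3
height (s2 , s0) = 4
height (s3 , s4) = 5
height (s0 , s2) = 1
height (s0 , s1) = 2
height (s4 , s0) = 3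
height (s3 , s0) = 4
height (s2 , s1) = 5
height (s2 , s3) = 1
height (s4 , s1) = 1
height _         = 0

∀-pair? : {Prop : Pair → Set} → (∀ P → Dec (Prop P)) → Dec (∀ P → Prop P)
∀-pair? P? =
  map′ (λ f (p , q) → f p q) (λ f p q → f (p , q)) (∀-state? λ p → ∀-state? λ q → P? (p , q))

distinct? : ∀ P → Dec (Distinct P)
distinct? (p , q) = ¬? (p ≟ˢ q)

moves-table : ∀ P l → Distinct P → All (λ Q → height P ≢ height Q) (δ² P l)
moves-table = from-yes (∀-pair? λ P → ∀-letter? λ l →
  distinct? P →-dec all-dec (λ Q → ¬? (height P ≟ⁿ height Q)) (δ² P l))

one-down-table : ∀ P l m → Distinct P →
  All (λ Q → All (λ R → height Q < height P → height R < height P → l ≡ m) (δ² P m)) (δ² P l)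
one-down-table = from-yes (∀-pair? λ P → ∀-letter? λ l → ∀-letter? λ m →
  distinct? P →-dec all-dec (λ Q → all-dec (λ R →
    (height Q <? height P) →-dec (height R <? height P) →-dec (l ≟ˡ m)) (δ² P m)) (δ² P l))

one-up-table : ∀ P l m → Distinct P →
  All (λ Q → All (λ R → height P < height Q → height P < height R → l ≡ m) (δ² P m)) (δ² P l)
one-up-table = from-yes (∀-pair? λ P → ∀-letter? λ l → ∀-letter? λ m →
  distinct? P →-dec all-dec (λ Q → all-dec (λ R →
    (height P <? height Q) →-dec (height P <? height R) →-dec (l ≟ˡ m)) (δ² P m)) (δ² P l))

open Lines δ² Distinct height distinct-step δ²-reverse
  (λ {P} {l} d → at-just (moves-table P l d))
  (λ {P} {l} {m} d edge edge′ → at-just (at-just (one-down-table P l m d) edge) edge′)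
  (λ {P} {l} {m} d edge edge′ → at-just (at-just (one-up-table P l m d) edge) edge′)

no-common-loop : ∀ {p q w} → p ≢ q → Reduced w → w ≢ [] → Path δ p w p → Path δ q w q → ⊥
no-common-loop p≢q red w≢[] p-loop q-loop = no-reduced-cycle p≢q red w≢[] (pair-path p-loop q-loop)

rotation-loop : ∀ {q q₁ l h₁} → δ q l ≡ just q₁ → Path δ q₁ h₁ q →
                Path δ q₁ (reduce (h₁ · (l ∷ []))) q₁
rotation-loop {l = l} {h₁} edge loop =
  reduce-core-path (h₁ · (l ∷ [])) (path-act (path-++ loop (edge ∷ [])))

-- The rotation is conjugate to l h₁, hence non-trivial when l h₁ is reduced.
rotation-nontrivial : ∀ {l h₁} → Reduced (l ∷ h₁) → reduce (h₁ · (l ∷ [])) ≢ []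
rotation-nontrivial {l} {h₁} red rotation≈e = ∷≢[] (trans (sym (reduce-of-reduced red)) conjugate≈e)
  where
    ∷≢[] : l ∷ h₁ ≢ []
    ∷≢[] ()
    rotation : Word
    rotation = h₁ · (l ∷ [])
    conjugate≈e : (l ∷ h₁) ≈ e
    conjugate≈e = begin
      l ∷ h₁                             ≈⟨ sym (··⁻¹-cancel (l ∷ h₁) (l ∷ [])) ⟩
      (l ∷ []) · rotation · (l ∷ []) ⁻¹  ≈⟨ conjugate-trivial (l ∷ []) rotation rotation≈e ⟩
      e                                  ∎
      where open SetoidReasoning F₂

rotation-fixes : ∀ {s r l} h₁ → Valid (s , r) → act (s , r) h₁ ≡ (s , invL l ∷ r) →
                 act (s , r) (reduce (h₁ · (l ∷ []))) ≡ (s , r)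
rotation-fixes {s} {r} {l} h₁ valid moved = begin
  act (s , r) (reduce (h₁ · (l ∷ [])))   ≡⟨ act-reduce (s , r) (h₁ · (l ∷ [])) valid ⟩
  act (s , r) (h₁ · (l ∷ []))            ≡⟨ act-· (s , r) h₁ (l ∷ []) ⟩
  step (act (s , r) h₁) l                ≡⟨ cong (λ c → step c l) moved ⟩
  (s , push l (invL l ∷ r))              ≡⟨ cong (s ,_) (push-cancels r (cancels-invL l)) ⟩
  (s , r)                                ∎
  where open ≡-Reasoning

-- By induction on the hair: a loop fixing (s , m ∷ r) must start with m⁻¹
-- (otherwise the hair grows), and its rotation fixes (s , r); by induction
-- that coset is the base point of the rotated loop, which contradicts the
-- hair m leaving Γ at s.
loop-fixed-point : ∀ r {s q h} → Valid (s , r) → Reduced h → h ≢ [] → Path δ q h q →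
                   act (s , r) h ≡ (s , r) → (s , r) ≡ (q , [])
loop-fixed-point [] {s} {q} _ red h≢[] loop fixed with s ≟ˢ q
... | yes refl = refl
... | no s≢q   = ⊥-elim (no-common-loop s≢q red h≢[] (core-path _ red fixed) loop)
loop-fixed-point (m ∷ r) _ _ h≢[] [] _ = ⊥-elim (h≢[] refl)
loop-fixed-point (m ∷ r) {h = l ∷ h₁} valid red _ (edge ∷ loop) fixed with cancels l m in eq
... | false = ⊥-elim (ʳ++-longer h₁ (cong proj₂ (trans (sym (hair-grows h₁ red)) fixed)))
... | true with refl ← cancels⇒invL l m eq
  with refl ← loop-fixed-point r (valid-tail valid) (reduce-reduced (h₁ · (l ∷ [])))
                (rotation-nontrivial red) (rotation-loop edge loop)
                (rotation-fixes h₁ (valid-tail valid) fixed)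
  with () ← trans (sym (δ-reverse edge)) (drop-just (proj₂ valid))

-- A non-trivial h ∈ H whose conjugate g h g⁻¹ lies in H forces g ∈ H:
-- the reduced form of h is a loop of Γ at s0 fixing the coset base·g,
-- so base·g is the base coset.
conjugate-into-H : ∀ g h → h ∈H → reduce h ≢ [] → (g · h · g ⁻¹) ∈H → g ∈H
conjugate-into-H g h h∈H h≉e ghg⁻¹∈H = stabiliser⊆H g c≡base
  where
    c : Coset
    c = act base g
    c-valid : Valid c
    c-valid = act-valid base g valid-core
    h-loop : Path δ s0 (reduce h) s0
    h-loop = reduce-core-path h (H-fixes-base h h∈H)
    h-fixes-c : act c (reduce h) ≡ c
    h-fixes-c = trans (act-reduce c h c-valid)
                      (act-conjugate base g h valid-core (H-fixes-base (g · h · g ⁻¹) ghg⁻¹∈H))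
    c≡base : c ≡ base
    c≡base = loop-fixed-point (proj₂ c) c-valid (reduce-reduced h) h≉e h-loop h-fixes-c

lemma8p1 : ∀ (g k : Word) → ¬ (g ∈H) → k ∈H
         → (∃[ h ] (h ∈H × k ≈ g · h · g ⁻¹)) → k ≈ e
lemma8p1 g k g∉H k∈H (h , h∈H , k≈ghg⁻¹) with list-≡-dec _≟ˡ_ (reduce h) e
... | yes h≈e = trans k≈ghg⁻¹ (conjugate-trivial g h h≈e)
... | no  h≉e = ⊥-elim (g∉H (conjugate-into-H g h h∈H h≉e ghg⁻¹∈H))
  where
    ghg⁻¹∈H : (g · h · g ⁻¹) ∈H
    ghg⁻¹∈H = ∈H-resp-≈ k (g · h · g ⁻¹) k≈ghg⁻¹ k∈H
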